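{- Let $(P,\varphi)$ be a closure space of semilattice type whose underlying poset $P$ is well-founded. Then the poset $\operatorname{Clop}(P,\varphi)$ is tight in $\operatorname{Reg}(P,\varphi)$.
   Context: A closure operator $\varphi$ on a set $P$ is extensive, idempotent, isotone with $\varphi(\varnothing)=\varnothing$; it is algebraic if $\varphi(\boldsymbol{x})$ is the union of $\varphi(\boldsymbol{y})$ for finite $\boldsymbol{y}\subseteq\boldsymbol{x}$. A minimal covering of $p$ is a set $\boldsymbol{x}$, minimal under inclusion, with $p\in\varphi(\boldsymbol{x})$. An algebraic closure space $(P,\varphi)$ with $P$ a poset has semilattice type if for every $p$ and every minimal covering $\boldsymbol{x}$ of $p$, $p$ is the join of $\boldsymbol{x}$ in $P$. Well-founded: every nonempty subset of $P$ has a minimal element. $\check\varphi(\boldsymbol{x})=P\setminus\varphi(P\setminus\boldsymbol{x})$; clopen means $\varphi(\boldsymbol{x})=\boldsymbol{x}=\check\varphi(\boldsymbol{x})$; regular closed means $\boldsymbol{x}=\varphi\check\varphi(\boldsymbol{x})$. $\operatorname{Reg}(P,\varphi)$ is the complete lattice of regular closed sets under inclusion (joins $\varphi(\bigcup)$, meets $\varphi\check\varphi(\bigcap)$), containing the poset $\operatorname{Clop}(P,\varphi)$ of clopen sets. A subset $K$ of a poset $L$ is tight in $L$ if every join (resp. meet) of a subset $X\subseteq K$ that exists in $K$ is also the join (resp. meet) of $X$ in $L$. -}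

module Defs where

open import Level using (Level; suc; _⊔_)
open import Data.Product using (Σ; ∃; _×_; _,_)
open import Data.List using (List)
open import Data.List.Relation.Unary.All using (All)
open import Data.List.Membership.Propositional using (_∈_)
open import Relation.Nullary using (¬_)
open import Relation.Binary.Core using (Rel)
open import Relation.Binary.Structures using (IsPartialOrder)
open import Relation.Binary.PropositionalEquality using (_≡_)

Subset : ∀ {ℓ} → Set ℓ → Set (suc ℓ)
Subset {ℓ} A = A → Set ℓ

module _ {ℓ : Level} {P : Set ℓ} where

  _⊆_ : Subset P → Subset P → Set ℓ
  x ⊆ y = ∀ p → x p → y p

  _≐_ : Subset P → Subset P → Set ℓ
  x ≐ y = (x ⊆ y) × (y ⊆ x)

  ∅ : Subset P
  ∅ _ = Lift⊥
    where open import Data.Empty.Polymorphic renaming (⊥ to Lift⊥)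

  ∁ : Subset P → Subset P
  ∁ x p = ¬ x p

  ⟦_⟧ : List P → Subset P
  ⟦ ys ⟧ p = p ∈ ys

  record IsClosureOperator (φ : Subset P → Subset P) : Set (suc ℓ) where
    field
      extensive  : ∀ x → x ⊆ φ x
      idempotent : ∀ x → φ (φ x) ≐ φ x
      isotone    : ∀ x y → x ⊆ y → φ x ⊆ φ y
      empty      : φ ∅ ≐ ∅

  FiniteUnion : (Subset P → Subset P) → Subset P → Subset P
  FiniteUnion φ x p = Σ (List P) λ ys → All x ys × φ ⟦ ys ⟧ p

  record IsAlgebraicClosureOperator (φ : Subset P → Subset P) : Set (suc ℓ) where
    field
      isClosure : IsClosureOperator φ
      algebraic : ∀ x → φ x ≐ FiniteUnion φ x

  MinimalCovering : (Subset P → Subset P) → P → Subset P → Set (suc ℓ)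
  MinimalCovering φ p x = φ x p × (∀ y → y ⊆ x → φ y p → x ⊆ y)

  dual : (Subset P → Subset P) → Subset P → Subset P
  dual φ x = ∁ (φ (∁ x))

  Clopen : (Subset P → Subset P) → Subset P → Set ℓ
  Clopen φ x = (φ x ≐ x) × (dual φ x ≐ x)

  RegularClosed : (Subset P → Subset P) → Subset P → Set ℓ
  RegularClosed φ x = x ≐ φ (dual φ x)

  IsJoinIn : (K X : Subset P → Set ℓ) → Subset P → Set (suc ℓ)
  IsJoinIn K X z = K z × (∀ w → X w → w ⊆ z)
                       × (∀ u → K u → (∀ w → X w → w ⊆ u) → z ⊆ u)

  IsMeetIn : (K X : Subset P → Set ℓ) → Subset P → Set (suc ℓ)
  IsMeetIn K X z = K z × (∀ w → X w → z ⊆ w)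
                       × (∀ u → K u → (∀ w → X w → u ⊆ w) → u ⊆ z)

  Tight : (K L : Subset P → Set ℓ) → Set (suc ℓ)
  Tight K L = ∀ (X : Subset P → Set ℓ) → (∀ w → X w → K w) →
                (∀ z → IsJoinIn K X z → IsJoinIn L X z)
              × (∀ z → IsMeetIn K X z → IsMeetIn L X z)

module _ {ℓ : Level} {P : Set ℓ} (_≤_ : Rel P ℓ) where

  IsJoin : Subset P → P → Set ℓ
  IsJoin x p = (∀ q → x q → q ≤ p) × (∀ u → (∀ q → x q → q ≤ u) → p ≤ u)

  SemilatticeType : (Subset P → Subset P) → Set (suc ℓ)
  SemilatticeType φ = ∀ p x → MinimalCovering φ p x → IsJoin x p

  WellFoundedPoset : Set (suc ℓ)
  WellFoundedPoset = ∀ (S : Subset P) → (∃ λ s → S s) →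
                       ∃ λ m → S m × (∀ s → S s → s ≤ m → s ≡ m)

-- Key fact: if a clopen set A is the least clopen set containing some U ⊆ A, then
-- A ⊆ φ U. Otherwise, by well-foundedness, pick a minimal p ∈ A ∖ φ U; the set of
-- points that are not below p or lie in φ U is clopen (semilattice type keeps the
-- minimal coverings of points ≤ p below p) and contains U but not p. For a clopen
-- join z of X and a regular closed upper bound u, z is the least clopen set
-- containing u ∩ z, so z ⊆ φ (u ∩ z) ⊆ u; meets are handled dually, with complements.
module Submission where

open import Defs
open import Level using (Level)
open import Axiom.ExcludedMiddle using (ExcludedMiddle)
open import Axiom.DoubleNegationElimination using (em⇒dne)
open import Relation.Binary.Core using (Rel)
open import Relation.Binary.Structures using (IsPartialOrder)
open import Relation.Binary.PropositionalEquality using (_≡_; refl; subst)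
open import Data.Product using (Σ; ∃; _×_; _,_; proj₁; proj₂)
open import Data.Sum using (_⊎_; inj₁; inj₂)
open import Data.Empty using (⊥-elim)
open import Data.List using (List; []; _∷_)
open import Data.List.Relation.Unary.Any using (here; there)
import Data.List.Relation.Unary.All as All
open import Data.List.Membership.Propositional using (_∈_)
open import Relation.Nullary using (¬_; yes; no)

module _ {ℓ : Level} {P : Set ℓ} where

  _∩_ : Subset P → Subset P → Subset P
  (x ∩ y) t = x t × y t

  _∖_ : Subset P → P → Subset P
  (x ∖ a) t = x t × ¬ t ≡ a

module ClosureSpace {ℓ : Level} {P : Set ℓ}
    (φ : Subset P → Subset P) (isClosure : IsClosureOperator φ) where

  open IsClosureOperator isClosure

  Closed : Subset P → Set ℓ
  Closed x = φ x ⊆ x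

  Open : Subset P → Set ℓ
  Open x = Closed (∁ x)

  closure-closed : ∀ x → Closed (φ x)
  closure-closed x = proj₁ (idempotent x)

  closure-least : ∀ {x y} → x ⊆ y → Closed y → φ x ⊆ y
  closure-least {x} {y} x⊆y cl-y t h = cl-y t (isotone x y x⊆y t h)

  clopen⇒closed : ∀ {x} → Clopen φ x → Closed x
  clopen⇒closed ((φx⊆x , _) , _) = φx⊆x

  clopen⇒open : ∀ {x} → Clopen φ x → Open x
  clopen⇒open (_ , (_ , x⊆dual)) t h xt = x⊆dual t xt h

  clopen⇒regularClosed : ∀ {x} → Clopen φ x → RegularClosed φ x
  clopen⇒regularClosed {x} cx@(_ , (dual⊆x , x⊆dual)) =
    (λ t xt → extensive (dual φ x) t (x⊆dual t xt)) ,
    closure-least dual⊆x (clopen⇒closed cx)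

  regularClosed⇒closed : ∀ {x} → RegularClosed φ x → Closed x
  regularClosed⇒closed {x} (x⊆φdual , φdual⊆x) =
    λ t h → φdual⊆x t (closure-least x⊆φdual (closure-closed (dual φ x)) t h)

  module Classical (em : ExcludedMiddle ℓ) where

    dne : ∀ {A : Set ℓ} → ¬ ¬ A → A
    dne = em⇒dne em

    closed∧open⇒clopen : ∀ {x} → Closed x → Open x → Clopen φ x
    closed∧open⇒clopen {x} cl op =
      (cl , extensive x) ,
      (λ t ¬φ∁x → dne λ ¬xt → ¬φ∁x (extensive (∁ x) t ¬xt)) ,
      (λ t xt φ∁x → op t φ∁x xt)

    closed⇒open∁ : ∀ {x} → Closed x → Open (∁ x)
    closed⇒open∁ {x} cl t h ¬xt = ¬xt (closure-least (λ s → dne) cl t h)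

    module _ (algebraic : ∀ x → φ x ≐ FiniteUnion φ x) where

      -- Remove the listed points one by one whenever p stays covered without them.
      prune : ∀ p (ys : List P) m → φ m p →
              Σ (Subset P) λ m′ → m′ ⊆ m × φ m′ p ×
                (∀ a → a ∈ ys → m′ a → ¬ φ (m′ ∖ a) p)
      prune p [] m p∈φm = m , (λ _ mt → mt) , p∈φm , λ _ ()
      prune p (a ∷ ys) m p∈φm with em {φ (m ∖ a) p}
      ... | yes p∈φm∖a =
        let m′ , m′⊆m∖a , p∈φm′ , irred = prune p ys (m ∖ a) p∈φm∖a
            irred′ : ∀ b → b ∈ (a ∷ ys) → m′ b → ¬ φ (m′ ∖ b) p
            irred′ = λ { b (here refl) m′b _ → proj₂ (m′⊆m∖a b m′b) refl
                       ; b (there b∈ys) → irred b b∈ys }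
        in m′ , (λ t m′t → proj₁ (m′⊆m∖a t m′t)) , p∈φm′ , irred′
      ... | no p∉φm∖a =
        let m′ , m′⊆m , p∈φm′ , irred = prune p ys m p∈φm
            irred′ : ∀ b → b ∈ (a ∷ ys) → m′ b → ¬ φ (m′ ∖ b) p
            irred′ = λ { b (here refl) m′b p∈φm′∖b →
                           p∉φm∖a (isotone (m′ ∖ b) (m ∖ b)
                             (λ t (m′t , t≢b) → m′⊆m t m′t , t≢b) p p∈φm′∖b)
                       ; b (there b∈ys) → irred b b∈ys }
        in m′ , m′⊆m , p∈φm′ , irred′

      minimalCovering-⊆ : ∀ x p → φ x p →
                          ∃ λ m → m ⊆ x × MinimalCovering φ p m
      minimalCovering-⊆ x p p∈φx =
        let ys , ys⊆x , p∈φys = proj₁ (algebraic x) p p∈φx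
            m , m⊆ys , p∈φm , irred = prune p ys ⟦ ys ⟧ p∈φys
            minimal : ∀ y → y ⊆ m → φ y p → m ⊆ y
            minimal = λ y y⊆m p∈φy t mt → dne λ ¬yt →
              irred t (m⊆ys t mt) mt
                (isotone y (m ∖ t) (λ s s∈y → y⊆m s s∈y , λ { refl → ¬yt s∈y }) p p∈φy)
        in m , (λ t mt → All.lookup ys⊆x (m⊆ys t mt)) , p∈φm , minimal

module Tightness {ℓ : Level} (em : ExcludedMiddle ℓ)
    {P : Set ℓ} (_≤_ : Rel P ℓ) (po : IsPartialOrder _≡_ _≤_)
    (φ : Subset P → Subset P) (alg : IsAlgebraicClosureOperator φ)
    (semilattice : SemilatticeType _≤_ φ) (wf : WellFoundedPoset _≤_) where

  open IsAlgebraicClosureOperator alg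
  open IsClosureOperator isClosure
  open ClosureSpace φ isClosure
  open Classical em
  module PO = IsPartialOrder po

  below-join : ∀ {p m} → MinimalCovering φ p m → ∀ t → m t → t ≤ p
  below-join {p} {m} cov = proj₁ (semilattice p m cov)

  join-least : ∀ {p m} → MinimalCovering φ p m → ∀ u → (∀ t → m t → t ≤ u) → p ≤ u
  join-least {p} {m} cov = proj₂ (semilattice p m cov)

  cut : Subset P → P → Subset P
  cut U p t = ¬ t ≤ p ⊎ φ U t

  cut-below : ∀ {U p t} → cut U p t → t ≤ p → φ U t
  cut-below (inj₁ t≰p)  t≤p = ⊥-elim (t≰p t≤p)
  cut-below (inj₂ t∈φU) _   = t∈φU

  cut-closed : ∀ U p → Closed (cut U p)
  cut-closed U p r r∈φcut with em {r ≤ p}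
  ... | no r≰p = inj₁ r≰p
  ... | yes r≤p =
    let m , m⊆cut , cov = minimalCovering-⊆ algebraic (cut U p) r r∈φcut
        m⊆φU : m ⊆ φ U
        m⊆φU = λ t mt → cut-below (m⊆cut t mt) (PO.trans (below-join cov t mt) r≤p)
    in inj₂ (closure-least m⊆φU (closure-closed U) r (proj₁ cov))

  -- A minimal covering of r ∈ φ (∁ (cut U p)) lies below p and outside φ U, hence
  -- outside A by minimality of p; so r ∈ φ (∁ A) ⊆ ∁ A, yet r ∈ φ U ⊆ A.
  cut-open : ∀ {A U p} → Closed A → Open A → U ⊆ A →
             (∀ t → A t → ¬ φ U t → t ≤ p → t ≡ p) → Open (cut U p)
  cut-open {A} {U} {p} cl-A op-A U⊆A minimal r r∈φ∁cut r∈cut =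
    op-A r (isotone m (∁ A) m⊆∁A r (proj₁ cov)) (closure-least U⊆A cl-A r r∈φU)
    where
      covering : ∃ λ m → m ⊆ ∁ (cut U p) × MinimalCovering φ r m
      covering = minimalCovering-⊆ algebraic (∁ (cut U p)) r r∈φ∁cut

      m : Subset P
      m = proj₁ covering

      m⊆∁cut : m ⊆ ∁ (cut U p)
      m⊆∁cut = proj₁ (proj₂ covering)

      cov : MinimalCovering φ r m
      cov = proj₂ (proj₂ covering)

      m-below-p : ∀ t → m t → t ≤ p
      m-below-p t mt = dne λ t≰p → m⊆∁cut t mt (inj₁ t≰p)

      r≤p : r ≤ p
      r≤p = join-least cov p m-below-p

      r∈φU : φ U r
      r∈φU = cut-below r∈cut r≤p

      m⊆∁A : m ⊆ ∁ A
      m⊆∁A t mt At with minimal t At (λ t∈φU → m⊆∁cut t mt (inj₂ t∈φU)) (m-below-p t mt)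
      ... | refl = m⊆∁cut t mt
                     (inj₂ (subst (φ U) (PO.antisym r≤p (below-join cov t mt)) r∈φU))

  closedOpenHull⊆closure : ∀ {A U} → Closed A → Open A → U ⊆ A →
                           (∀ c → Closed c → Open c → U ⊆ c → A ⊆ c) → A ⊆ φ U
  closedOpenHull⊆closure {A} {U} cl-A op-A U⊆A hull q Aq = dne λ q∉φU →
    let p , (Ap , p∉φU) , minimal = wf (A ∩ ∁ (φ U)) (q , Aq , q∉φU)
        minimal′ = λ t At t∉φU t≤p → minimal t (At , t∉φU) t≤p
        U⊆cut = λ t Ut → inj₂ (extensive U t Ut)
        p∈cut = hull (cut U p) (cut-closed U p) (cut-open cl-A op-A U⊆A minimal′) U⊆cut p Ap
    in p∉φU (cut-below p∈cut PO.refl)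

  clopenJoin⊆upperBound : ∀ {X z u} → IsJoinIn (Clopen φ) X z →
                          RegularClosed φ u → (∀ w → X w → w ⊆ u) → z ⊆ u
  clopenJoin⊆upperBound {z = z} {u} (cz , z-ub , z-least) reg-u u-ub t zt =
    closure-least (λ _ → proj₁) (regularClosed⇒closed reg-u) t
      (closedOpenHull⊆closure (clopen⇒closed cz) (clopen⇒open cz) (λ _ → proj₂) hull t zt)
    where
      hull : ∀ c → Closed c → Open c → (u ∩ z) ⊆ c → z ⊆ c
      hull c cl-c op-c u∩z⊆c = z-least c (closed∧open⇒clopen cl-c op-c)
        λ w Xw s ws → u∩z⊆c s (u-ub w Xw s ws , z-ub w Xw s ws)

  lowerBound⊆clopenMeet : ∀ {X z u} → IsMeetIn (Clopen φ) X z →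
                          RegularClosed φ u → (∀ w → X w → u ⊆ w) → u ⊆ z
  lowerBound⊆clopenMeet {X} {z} {u} (cz , z-lb , z-greatest) reg-u u-lb t ut =
    closure-least dual⊆z (clopen⇒closed cz) t (proj₁ reg-u t ut)
    where
      hull : ∀ c → Closed c → Open c → (∁ u ∩ ∁ z) ⊆ c → ∁ z ⊆ c
      hull c cl-c op-c ∁u∩∁z⊆c s ¬zs = dne λ ¬cs →
        ¬zs (z-greatest (∁ c) (closed∧open⇒clopen op-c (closed⇒open∁ cl-c)) ∁c-lb s ¬cs)
        where
          ∁c-lb : ∀ w → X w → ∁ c ⊆ w
          ∁c-lb w Xw s ¬cs = dne λ ¬ws →
            ¬cs (∁u∩∁z⊆c s ((λ us → ¬ws (u-lb w Xw s us)) , (λ zs → ¬ws (z-lb w Xw s zs))))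

      ∁z⊆φ∁u : ∁ z ⊆ φ (∁ u)
      ∁z⊆φ∁u s ¬zs =
        isotone (∁ u ∩ ∁ z) (∁ u) (λ _ → proj₁) s
          (closedOpenHull⊆closure (clopen⇒open cz) (closed⇒open∁ (clopen⇒closed cz))
             (λ _ → proj₂) hull s ¬zs)

      dual⊆z : dual φ u ⊆ z
      dual⊆z s s∉φ∁u = dne λ ¬zs → s∉φ∁u (∁z⊆φ∁u s ¬zs)

  clopen-tight : Tight (Clopen φ) (RegularClosed φ)
  clopen-tight X _ =
    (λ { z join@(cz , z-ub , _) →
           clopen⇒regularClosed cz , z-ub , λ u reg-u → clopenJoin⊆upperBound join reg-u }) ,
    (λ { z meet@(cz , z-lb , _) →
           clopen⇒regularClosed cz , z-lb , λ u reg-u → lowerBound⊆clopenMeet meet reg-u })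

theorem16p2 : ∀ {ℓ : Level} → ExcludedMiddle ℓ →
    (P : Set ℓ) (_≤_ : Rel P ℓ) → IsPartialOrder _≡_ _≤_ →
    (φ : Subset P → Subset P) → IsAlgebraicClosureOperator φ →
    SemilatticeType _≤_ φ → WellFoundedPoset _≤_ →
    Tight (Clopen φ) (RegularClosed φ)
theorem16p2 em P _≤_ po φ alg semilattice wf =
  Tightness.clopen-tight em _≤_ po φ alg semilattice wf
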